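{- Let $\nu>1$ be an integer, let $S$ be a finite set of integers, and let $I\subseteq S$. Then for every $\bm g=(g_i)_{i\in S}\in Q_S(\nu)$, \[ \chi^I(\nu)(\bm g)=\prod_{i\in I}\mathbbm{1}(g_i)\prod_{j\in S\setminus I}(\mathbbm{reg}-\mathbbm{1})(g_j). \]
   Context: $C_\nu$ is the additive cyclic group of order $\nu$ with identity $0$. For a finite set $S$ of integers, $Q_S(\nu)=\bigoplus_{s\in S}C_\nu$ (tuples $(g_s)_{s\in S}$, identity $\bm 0$); for $I\subseteq S$, $Q_I(\nu)$ is identified with the subgroup of tuples with $g_s=0$ for $s\notin I$. For $I\subseteq S$ let $X_I$ be the set of irreducible characters $\psi$ of $Q_S(\nu)$ such that $Q_I(\nu)\subseteq\ker\psi$ but $Q_{I\cup\{j\}}(\nu)\not\subseteq\ker\psi$ for every $j\in S\setminus I$, and put $\chi^I(\nu)=\sum_{\psi\in X_I}\psi(\bm 0)\psi$ (these are the supercharacters of the normal supercharacter theory of $Q_S(\nu)$ attached to the sublattice $\{Q_I(\nu):I\subseteq S\}$ of normal subgroups). $\mathbbm{1}$ is the trivial character of $C_\nu$ and $\mathbbm{reg}$ the regular character of $C_\nu$ ($\mathbbm{reg}(0)=\nu$, $\mathbbm{reg}(g)=0$ for $g\neq 0$). -}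

module Defs where

open import Level using (Level; _⊔_)
open import Data.Nat as ℕ using (ℕ; zero; suc; _%_; _∸_)
import Data.Nat.Properties as ℕP
open import Data.Fin using (Fin; toℕ) renaming (zero to fzero; suc to fsuc)
open import Data.Fin.Subset using (Subset; _∈_; _∉_; _∪_; ⁅_⁆)
open import Data.Fin.Subset.Properties using (_∈?_)
open import Data.Bool using (Bool; true; false; _∧_; _∨_; not; if_then_else_)
open import Data.Vec.Functional using (Vector; _∷_)
open import Relation.Nullary using (¬_; Dec; yes; no)
open import Relation.Nullary.Decidable using (⌊_⌋)
open import Data.Sum using (_⊎_)
open import Data.Product using (_×_)
open import Data.Nat.Divisibility using (_∣?_)
open import Algebra.Bundles using (CommutativeRing)

-- The group C_ν is modelled by Fin ν (residues 0..ν-1, identity fzero).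
-- Q_S(ν) for |S| = n is modelled by functions Fin n → Fin ν.

allFin : (m : ℕ) → (Fin m → Bool) → Bool
allFin zero    p = true
allFin (suc m) p = p fzero ∧ allFin m (λ i → p (fsuc i))

allTuples : (ν n : ℕ) → ((Fin n → Fin ν) → Bool) → Bool
allTuples ν zero    p = p (λ ())
allTuples ν (suc n) p = allFin ν (λ x → allTuples ν n (λ t → p (x ∷ t)))

-- Pairing ⟨a,h⟩ = Σ_s a_s h_s (as a natural number; only its class mod ν matters)
pairing : {ν n : ℕ} → (Fin n → Fin ν) → (Fin n → Fin ν) → ℕ
pairing {n = zero}  a h = 0
pairing {n = suc n} a h = toℕ (a fzero) ℕ.* toℕ (h fzero)
                          ℕ.+ pairing {n = n} (λ i → a (fsuc i)) (λ i → h (fsuc i))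

inQ : {ν n : ℕ} → Subset n → (Fin n → Fin ν) → Bool
inQ {ν} {n} I h = allFin n (λ s → ⌊ s ∈? I ⌋ ∨ (toℕ (h s) ℕ.≡ᵇ 0))

-- Irreducible characters are ψ_a(h) = ζ^{⟨a,h⟩} (ζ a primitive ν-th root of unity);
-- h ∈ ker ψ_a  iff  ⟨a,h⟩ ≡ 0 (mod ν).
inKer : {ν n : ℕ} → (Fin n → Fin ν) → (Fin n → Fin ν) → Bool
inKer {ν} a h = ⌊ ν ∣? pairing a h ⌋

QsubKer : {ν n : ℕ} → Subset n → (Fin n → Fin ν) → Bool
QsubKer {ν} {n} I a = allTuples ν n (λ h → not (inQ I h) ∨ inKer a h)

inX : {ν n : ℕ} → Subset n → (Fin n → Fin ν) → Bool
inX {ν} {n} I a = QsubKer I a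
                  ∧ allFin n (λ j → ⌊ j ∈? I ⌋ ∨ not (QsubKer (I ∪ ⁅ j ⁆) a))

module Characters {c ℓ : Level} (R : CommutativeRing c ℓ) (ζ : CommutativeRing.Carrier R) where
  open CommutativeRing R

  pow : Carrier → ℕ → Carrier
  pow x zero    = 1#
  pow x (suc k) = x * pow x k

  IsPrimitiveRoot : ℕ → Set ℓ
  IsPrimitiveRoot ν = (pow ζ ν ≈ 1#) × (∀ k → 0 ℕ.< k → k ℕ.< ν → ¬ (pow ζ k ≈ 1#))

  IsIntegralDomain : Set (c ⊔ ℓ)
  IsIntegralDomain = ¬ (1# ≈ 0#) × (∀ x y → x * y ≈ 0# → (x ≈ 0#) ⊎ (y ≈ 0#))

  sumFin : (m : ℕ) → (Fin m → Carrier) → Carrier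
  sumFin zero    f = 0#
  sumFin (suc m) f = f fzero + sumFin m (λ i → f (fsuc i))

  prodFin : (m : ℕ) → (Fin m → Carrier) → Carrier
  prodFin zero    f = 1#
  prodFin (suc m) f = f fzero * prodFin m (λ i → f (fsuc i))

  sumTuples : (ν n : ℕ) → ((Fin n → Fin ν) → Carrier) → Carrier
  sumTuples ν zero    f = f (λ ())
  sumTuples ν (suc n) f = sumFin ν (λ x → sumTuples ν n (λ t → f (x ∷ t)))

  ψ : {ν n : ℕ} → (Fin n → Fin ν) → (Fin n → Fin ν) → Carrier
  ψ a g = pow ζ (pairing a g)

  𝟎 : {ν n : ℕ} → .{{ _ : ℕ.NonZero ν }} → Fin n → Fin ν
  𝟎 {suc ν} _ = fzero

  χ : {ν n : ℕ} → .{{ _ : ℕ.NonZero ν }} → Subset n → (Fin n → Fin ν) → Carrier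
  χ {ν} {n} I g = sumTuples ν n (λ a → if inX I a then ψ a 𝟎 * ψ a g else 0#)

  fromℕ : ℕ → Carrier
  fromℕ zero    = 0#
  fromℕ (suc k) = 1# + fromℕ k

  𝟙 : {ν : ℕ} → Fin ν → Carrier
  𝟙 _ = 1#

  reg : {ν : ℕ} → Fin ν → Carrier
  reg {ν} fzero    = fromℕ ν
  reg {ν} (fsuc _) = 0#

  rhs : {ν n : ℕ} → Subset n → (Fin n → Fin ν) → Carrier
  rhs {ν} {n} I g = prodFin n (λ s → if ⌊ s ∈? I ⌋ then 𝟙 (g s) else (reg (g s) - 𝟙 (g s)))

{-# OPTIONS --safe #-}
module Submission where

-- A character ψ_a contains Q_J(ν) in its kernel iff a vanishes on J (pair a with the unit
-- vectors supported in J), so X_I consists of the ψ_a with a_s = 0 exactly for s ∈ I. Since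
-- ψ_a(𝟎) = 1, χ^I(g) is the sum over these a of ∏_s ζ^(a_s g_s), and this factors into a
-- product over s of sums over C_ν: Σ_{x = 0} ζ^(x g_s) = 1 for s ∈ I and
-- Σ_{x ≠ 0} ζ^(x g_s) = reg(g_s) − 1 for s ∉ I. The latter holds because Σ_x ζ^(x y) is ν for
-- y = 0, and otherwise a geometric sum of the root of unity ζ^y ≠ 1, which vanishes in a domain.

open import Defs
open import Level using (Level)
open import Data.Nat as ℕ using (ℕ; zero; suc; s≤s; z≤n; z<s; NonZero; _<_)
import Data.Nat.Properties as ℕP
open import Data.Nat.Divisibility using (_∣_; _∣?_; _∣0; >⇒∤)
open import Data.Fin as Fin using (Fin; toℕ) renaming (zero to fzero; suc to fsuc)
open import Data.Fin.Properties using (toℕ<n; toℕ-inject₁; toℕ-fromℕ)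
open import Data.Fin.Subset using (Subset; _∈_; _∪_; ⁅_⁆)
open import Data.Fin.Subset.Properties using (_∈?_; x∈⁅x⁆; x∈⁅y⁆⇒x≡y; x∈p∪q⁻; x∈p∪q⁺)
open import Data.Bool using (Bool; true; false; T; _∧_; _∨_; not; if_then_else_)
open import Data.Bool.Properties using (T-∧; T-∨; T-≡; ⇔→≡)
open import Data.Vec.Functional using (Vector; _∷_)
open import Data.Product using (_,_; proj₁; proj₂)
open import Data.Sum using (_⊎_; inj₁; inj₂; [_,_])
import Data.Sum as Sum
open import Function using (_∘_; id; Equivalence; mk⇔)
open import Relation.Nullary using (¬_; Dec; yes; no; contradiction)
open import Relation.Nullary.Decidable using (⌊_⌋; toWitness; fromWitness)
open import Relation.Binary.Core using (_Preserves_⟶_)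
open import Relation.Binary.PropositionalEquality using (_≡_; refl; sym; trans; cong; cong₂; subst; _≗_)
open import Algebra.Bundles using (CommutativeRing)

open Equivalence using (to; from)

T-not⁺ : ∀ {x} → ¬ T x → T (not x)
T-not⁺ {false} _  = _
T-not⁺ {true}  ¬x = ¬x _

T-not⁻ : ∀ {x} → T (not x) → ¬ T x
T-not⁻ {false} _ ()
T-not⁻ {true}  ()

T-implication⁺ : ∀ {x y} → (T x → T y) → T (not x ∨ y)
T-implication⁺ {false} _   = _
T-implication⁺ {true}  x⇒y = x⇒y _

T-implication⁻ : ∀ {x y} → T (not x ∨ y) → T x → T y
T-implication⁻ {true} y _ = y

allFin⁺ : ∀ m {p : Fin m → Bool} → (∀ i → T (p i)) → T (allFin m p)
allFin⁺ zero    _   = _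
allFin⁺ (suc m) all = from T-∧ (all fzero , allFin⁺ m (all ∘ fsuc))

allFin⁻ : ∀ m {p : Fin m → Bool} → T (allFin m p) → ∀ i → T (p i)
allFin⁻ (suc m) t fzero    = proj₁ (to T-∧ t)
allFin⁻ (suc m) t (fsuc i) = allFin⁻ m (proj₂ (to T-∧ t)) i

allFin-cong : ∀ m {p q : Fin m → Bool} → p ≗ q → allFin m p ≡ allFin m q
allFin-cong zero    _   = refl
allFin-cong (suc m) p≗q = cong₂ _∧_ (p≗q fzero) (allFin-cong m (p≗q ∘ fsuc))

allTuples⁺ : ∀ ν n {p : (Fin n → Fin ν) → Bool} → (∀ h → T (p h)) → T (allTuples ν n p)
allTuples⁺ ν zero    all = all _
allTuples⁺ ν (suc n) all = allFin⁺ ν (λ x → allTuples⁺ ν n (λ t → all (x ∷ t)))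

-- Without function extensionality h is only pointwise equal to h fzero ∷ h ∘ fsuc,
-- hence the hypothesis on p.
allTuples⁻ : ∀ ν n {p : (Fin n → Fin ν) → Bool} → p Preserves _≗_ ⟶ _≡_ →
             T (allTuples ν n p) → ∀ h → T (p h)
allTuples⁻ ν zero    resp holds h = subst T (resp (λ ())) holds
allTuples⁻ ν (suc n) resp holds h =
  subst T (resp head∷tail≗h) (allTuples⁻ ν n (resp ∘ ∷-cong) (allFin⁻ ν holds (h fzero)) (h ∘ fsuc))
  where
  head∷tail≗h : h fzero ∷ h ∘ fsuc ≗ h
  head∷tail≗h fzero    = refl
  head∷tail≗h (fsuc i) = refl
  ∷-cong : ∀ {t u} → t ≗ u → h fzero ∷ t ≗ h fzero ∷ u
  ∷-cong t≗u fzero    = refl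
  ∷-cong t≗u (fsuc i) = t≗u i

-- The zero test used by inQ, so that inQ unfolds to it definitionally.
isZero : ∀ {ν} → Fin ν → Bool
isZero x = toℕ x ℕ.≡ᵇ 0

product≡0 : ∀ {ν} (x y : Fin ν) → T (isZero x) ⊎ T (isZero y) → toℕ x ℕ.* toℕ y ≡ 0
product≡0 fzero    _        _ = refl
product≡0 (fsuc x) fzero    _ = ℕP.*-zeroʳ (suc (toℕ x))
product≡0 (fsuc x) (fsuc y) (inj₁ ())
product≡0 (fsuc x) (fsuc y) (inj₂ ())

pairing≡0 : ∀ {ν n} (a h : Fin n → Fin ν) → (∀ s → T (isZero (a s)) ⊎ T (isZero (h s))) →
            pairing a h ≡ 0
pairing≡0 {n = zero}  a h _        = refl
pairing≡0 {n = suc n} a h disjoint =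
  cong₂ ℕ._+_ (product≡0 (a fzero) (h fzero) (disjoint fzero))
              (pairing≡0 (a ∘ fsuc) (h ∘ fsuc) (disjoint ∘ fsuc))

pairing-cong : ∀ {ν n} (a : Fin n → Fin ν) → pairing a Preserves _≗_ ⟶ _≡_
pairing-cong {n = zero}  a _    = refl
pairing-cong {n = suc n} a h≗k =
  cong₂ ℕ._+_ (cong (λ x → toℕ (a fzero) ℕ.* toℕ x) (h≗k fzero))
              (pairing-cong (a ∘ fsuc) (h≗k ∘ fsuc))

unit : ∀ {m n} → Fin n → Fin n → Fin (suc (suc m))
unit fzero    = fsuc fzero ∷ λ _ → fzero
unit (fsuc s) = fzero ∷ unit s

unit-support : ∀ {m n} (s i : Fin n) → i ≡ s ⊎ T (isZero (unit {m} s i))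
unit-support fzero    fzero    = inj₁ refl
unit-support fzero    (fsuc i) = inj₂ _
unit-support (fsuc s) fzero    = inj₂ _
unit-support (fsuc s) (fsuc i) = Sum.map₁ (cong fsuc) (unit-support s i)

pairing-unit : ∀ {m n} (a : Fin n → Fin (suc (suc m))) (s : Fin n) → pairing a (unit s) ≡ toℕ (a s)
pairing-unit a fzero    =
  trans (cong₂ ℕ._+_ (ℕP.*-identityʳ (toℕ (a fzero))) (pairing≡0 (a ∘ fsuc) _ (λ _ → inj₂ _)))
        (ℕP.+-identityʳ (toℕ (a fzero)))
pairing-unit a (fsuc s) = cong₂ ℕ._+_ (ℕP.*-zeroʳ (toℕ (a fzero))) (pairing-unit (a ∘ fsuc) s)

∣toℕ⇒isZero : ∀ {ν} (x : Fin ν) → ν ∣ toℕ x → T (isZero x)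
∣toℕ⇒isZero fzero    _   = _
∣toℕ⇒isZero (fsuc x) ν∣x = contradiction ν∣x (>⇒∤ (toℕ<n (fsuc x)))

module _ {ν n : ℕ} (J : Subset n) where

  inQ⁺ : (h : Fin n → Fin ν) → (∀ s → s ∈ J ⊎ T (isZero (h s))) → T (inQ J h)
  inQ⁺ h supported = allFin⁺ n (λ s → from T-∨ (Sum.map₁ fromWitness (supported s)))

  inQ⁻ : (h : Fin n → Fin ν) → T (inQ J h) → ∀ s → s ∈ J ⊎ T (isZero (h s))
  inQ⁻ h t s = Sum.map₁ toWitness (to T-∨ (allFin⁻ n t s))

  inQ-cong : inQ {ν} J Preserves _≗_ ⟶ _≡_
  inQ-cong h≗k = allFin-cong n (λ s → cong (λ x → ⌊ s ∈? J ⌋ ∨ isZero x) (h≗k s))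

VanishesOn : ∀ {ν n} → Subset n → (Fin n → Fin ν) → Set
VanishesOn J a = ∀ {s} → s ∈ J → T (isZero (a s))

vanishesOn-∪⁅⁆ : ∀ {ν n} {I : Subset n} {a : Fin n → Fin ν} {j} →
                 VanishesOn I a → T (isZero (a j)) → VanishesOn (I ∪ ⁅ j ⁆) a
vanishesOn-∪⁅⁆ {I = I} {a} {j} a|I≡0 aj≡0 s∈ =
  [ a|I≡0 , (λ s∈⁅j⁆ → subst (T ∘ isZero ∘ a) (sym (x∈⁅y⁆⇒x≡y j s∈⁅j⁆)) aj≡0) ] (x∈p∪q⁻ I ⁅ j ⁆ s∈)

QsubKer⁺ : ∀ {ν n} (J : Subset n) (a : Fin n → Fin ν) → VanishesOn J a → T (QsubKer J a)
QsubKer⁺ {ν} {n} J a a|J≡0 = allTuples⁺ ν n (λ h → T-implication⁺ (λ h∈Q →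
  fromWitness (subst (ν ∣_) (sym (pairing≡0 a h (Sum.map₁ a|J≡0 ∘ inQ⁻ J h h∈Q))) (ν ∣0))))

-- Testing against the unit vector at s ∈ J gives ν ∣ a_s < ν.
QsubKer⁻ : ∀ {m n} (J : Subset n) (a : Fin n → Fin (suc (suc m))) → T (QsubKer J a) → VanishesOn J a
QsubKer⁻ {m} {n} J a J⊆ker {s} s∈J =
  ∣toℕ⇒isZero (a s) (subst (ν ∣_) (pairing-unit a s) (toWitness unit∈ker))
  where
  ν = suc (suc m)
  resp : (λ h → not (inQ J h) ∨ inKer a h) Preserves _≗_ ⟶ _≡_
  resp h≗k = cong₂ (λ q k → not q ∨ ⌊ ν ∣? k ⌋) (inQ-cong J h≗k) (pairing-cong a h≗k)
  unit∈Q : T (inQ J (unit s))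
  unit∈Q = inQ⁺ J (unit s) (λ i → Sum.map₁ (λ i≡s → subst (_∈ J) (sym i≡s) s∈J) (unit-support s i))
  unit∈ker : T (inKer a (unit s))
  unit∈ker = T-implication⁻ (allTuples⁻ ν n resp J⊆ker (unit s)) unit∈Q

vanishesIff : ∀ {ν} → Bool → Fin ν → Bool
vanishesIff b x = if b then isZero x else not (isZero x)

vanishesExactlyOn : ∀ {ν n} → Subset n → (Fin n → Fin ν) → Bool
vanishesExactlyOn {n = n} I a = allFin n (λ s → vanishesIff ⌊ s ∈? I ⌋ (a s))

module _ {m n : ℕ} (I : Subset n) (a : Fin n → Fin (suc (suc m))) where

  inX⇒vanishesExactlyOn : T (inX I a) → T (vanishesExactlyOn I a)
  inX⇒vanishesExactlyOn t = allFin⁺ n (λ s → coordinate (s ∈? I) (allFin⁻ n (proj₂ (to T-∧ t)) s))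
    where
    a|I≡0 : VanishesOn I a
    a|I≡0 = QsubKer⁻ I a (proj₁ (to T-∧ t))
    coordinate : ∀ {s} (s∈?I : Dec (s ∈ I)) → T (⌊ s∈?I ⌋ ∨ not (QsubKer (I ∪ ⁅ s ⁆) a)) →
                 T (vanishesIff ⌊ s∈?I ⌋ (a s))
    coordinate (yes s∈I) _        = a|I≡0 s∈I
    coordinate (no _)    I∪s⊈ker = T-not⁺ (λ as≡0 →
      T-not⁻ I∪s⊈ker (QsubKer⁺ (I ∪ ⁅ _ ⁆) a (vanishesOn-∪⁅⁆ {a = a} a|I≡0 as≡0)))

  vanishesExactlyOn⇒inX : T (vanishesExactlyOn I a) → T (inX I a)
  vanishesExactlyOn⇒inX t =
    from T-∧ (QsubKer⁺ I a (λ {s} s∈I → vanishing (s ∈? I) s∈I (allFin⁻ n t s)) ,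
              allFin⁺ n (λ j → maximal (j ∈? I) (allFin⁻ n t j)))
    where
    vanishing : ∀ {s} (s∈?I : Dec (s ∈ I)) → s ∈ I → T (vanishesIff ⌊ s∈?I ⌋ (a s)) → T (isZero (a s))
    vanishing (yes _)   _   as≡0 = as≡0
    vanishing (no s∉I) s∈I _    = contradiction s∈I s∉I
    maximal : ∀ {j} (j∈?I : Dec (j ∈ I)) → T (vanishesIff ⌊ j∈?I ⌋ (a j)) →
              T (⌊ j∈?I ⌋ ∨ not (QsubKer (I ∪ ⁅ j ⁆) a))
    maximal     (yes _) _    = _
    maximal {j} (no _)  aj≢0 = T-not⁺ (λ I∪j⊆ker →
      T-not⁻ aj≢0 (QsubKer⁻ (I ∪ ⁅ j ⁆) a I∪j⊆ker (x∈p∪q⁺ (inj₂ (x∈⁅x⁆ j)))))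

  inX≡vanishesExactlyOn : inX I a ≡ vanishesExactlyOn I a
  inX≡vanishesExactlyOn = ⇔→≡ {z = true} (mk⇔ (to T-≡ ∘ inX⇒vanishesExactlyOn ∘ from T-≡)
                                               (to T-≡ ∘ vanishesExactlyOn⇒inX ∘ from T-≡))

module CommutativeRingSums {c ℓ} (R : CommutativeRing c ℓ) where
  open CommutativeRing R renaming (refl to ≈-refl; sym to ≈-sym; trans to ≈-trans)
  open import Algebra.Properties.Ring ring using (+-cancelʳ; x∙y⁻¹≈ε⇒x≈y; [y-z]x≈yx-zx)
  open import Algebra.Properties.Semiring.Sum semiring using (sum; sum-cong-≗; *-distribˡ-sum; sum-init-last)
  open import Algebra.Properties.Semiring.Exp semiring using (_^_; ^-congˡ; ^-assocʳ)
  open import Relation.Binary.Reasoning.Setoid setoid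

  NoZeroDivisors : Set (c Level.⊔ ℓ)
  NoZeroDivisors = ∀ x y → x * y ≈ 0# → x ≈ 0# ⊎ y ≈ 0#

  if-then-cong : ∀ b {x y z} → x ≈ y → (if b then x else z) ≈ (if b then y else z)
  if-then-cong true  x≈y = x≈y
  if-then-cong false _   = ≈-refl

  *-if : ∀ b x y → x * (if b then y else 0#) ≈ (if b then x * y else 0#)
  *-if true  x y = ≈-refl
  *-if false x y = zeroʳ x

  1#^n≈1# : ∀ n → 1# ^ n ≈ 1#
  1#^n≈1# zero    = ≈-refl
  1#^n≈1# (suc n) = ≈-trans (*-identityˡ _) (1#^n≈1# n)

  ^-root-of-unity : ∀ {w} ν t → w ^ ν ≈ 1# → (w ^ t) ^ ν ≈ 1#
  ^-root-of-unity {w} ν t w^ν≈1 = begin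
    (w ^ t) ^ ν    ≈⟨ ^-assocʳ w t ν ⟩
    w ^ (t ℕ.* ν)  ≡⟨ cong (w ^_) (ℕP.*-comm t ν) ⟩
    w ^ (ν ℕ.* t)  ≈⟨ ^-assocʳ w ν t ⟨
    (w ^ ν) ^ t    ≈⟨ ^-congˡ t w^ν≈1 ⟩
    1# ^ t         ≈⟨ 1#^n≈1# t ⟩
    1#             ∎

  powers : Carrier → (N : ℕ) → Vector Carrier N
  powers w N i = w ^ toℕ i

  -- Split off the first term (as a factor w) and the last term of Σ_{i ≤ N} w^i.
  sum-powers-telescope : ∀ w N → w * sum (powers w N) + 1# ≈ sum (powers w N) + w ^ N
  sum-powers-telescope w N = begin
    w * sum (powers w N) + 1#  ≈⟨ +-comm _ 1# ⟩
    1# + w * sum (powers w N)  ≈⟨ +-congˡ (*-distribˡ-sum w (powers w N)) ⟩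
    sum (powers w (suc N))     ≈⟨ sum-init-last (powers w (suc N)) ⟩
    sum (powers w (suc N) ∘ Fin.inject₁) + w ^ toℕ (Fin.fromℕ N)
      ≡⟨ cong₂ _+_ (sum-cong-≗ {N} (λ i → cong (w ^_) (toℕ-inject₁ i))) (cong (w ^_) (toℕ-fromℕ N)) ⟩
    sum (powers w N) + w ^ N   ∎

  sum-powers≈0 : NoZeroDivisors → ∀ {w} N → ¬ w ≈ 1# → w ^ N ≈ 1# → sum (powers w N) ≈ 0#
  sum-powers≈0 noZeroDivisors {w} N w≉1 w^N≈1 =
    [ (λ w-1≈0 → contradiction (x∙y⁻¹≈ε⇒x≈y w 1# w-1≈0) w≉1) , id ] (noZeroDivisors _ _ [w-1]S≈0)
    where
    S = sum (powers w N)
    wS≈S : w * S ≈ S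
    wS≈S = +-cancelʳ 1# _ _ (≈-trans (sum-powers-telescope w N) (+-congˡ w^N≈1))
    [w-1]S≈0 : (w - 1#) * S ≈ 0#
    [w-1]S≈0 = begin
      (w - 1#) * S    ≈⟨ [y-z]x≈yx-zx S w 1# ⟩
      w * S - 1# * S  ≈⟨ +-cong wS≈S (-‿cong (*-identityˡ S)) ⟩
      S - S           ≈⟨ -‿inverseʳ S ⟩
      0#              ∎

module CharacterSums {c ℓ} (R : CommutativeRing c ℓ) (ζ : CommutativeRing.Carrier R) where
  open CommutativeRing R renaming (refl to ≈-refl; sym to ≈-sym; trans to ≈-trans)
  open Characters R ζ
  open CommutativeRingSums R
  open import Algebra.Properties.Ring ring using (xyx⁻¹≈y)
  open import Algebra.Properties.Semiring.Sum semiring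
    using (sum; sum-cong-≋; sum-cong-≗; *-distribˡ-sum; *-distribʳ-sum; sum-replicate-zero)
  open import Algebra.Properties.Semiring.Exp semiring using (_^_; ^-homo-*; ^-assocʳ)
  open import Relation.Binary.Reasoning.Setoid setoid

  pow≡^ : ∀ x k → pow x k ≡ x ^ k
  pow≡^ x zero    = refl
  pow≡^ x (suc k) = cong (x *_) (pow≡^ x k)

  sumFin≡sum : ∀ m (f : Fin m → Carrier) → sumFin m f ≡ sum f
  sumFin≡sum zero    f = refl
  sumFin≡sum (suc m) f = cong (f fzero +_) (sumFin≡sum m (f ∘ fsuc))

  sum-ones≡fromℕ : ∀ N → sum {N} (λ _ → 1#) ≡ fromℕ N
  sum-ones≡fromℕ zero    = refl
  sum-ones≡fromℕ (suc N) = cong (1# +_) (sum-ones≡fromℕ N)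

  prodFin-cong : ∀ m {f g : Fin m → Carrier} → (∀ i → f i ≈ g i) → prodFin m f ≈ prodFin m g
  prodFin-cong zero    _   = ≈-refl
  prodFin-cong (suc m) f≈g = *-cong (f≈g fzero) (prodFin-cong m (f≈g ∘ fsuc))

  sumTuples-suc : ∀ ν n (f : (Fin (suc n) → Fin ν) → Carrier) →
                  sumTuples ν (suc n) f ≡ sum (λ x → sumTuples ν n (λ t → f (x ∷ t)))
  sumTuples-suc ν n f = sumFin≡sum ν _

  sumTuples-cong : ∀ ν n {f g : (Fin n → Fin ν) → Carrier} → (∀ a → f a ≈ g a) →
                   sumTuples ν n f ≈ sumTuples ν n g
  sumTuples-cong ν zero    f≈g = f≈g _
  sumTuples-cong ν (suc n) {f} {g} f≈g rewrite sumTuples-suc ν n f | sumTuples-suc ν n g =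
    sum-cong-≋ {ν} (λ x → sumTuples-cong ν n (λ t → f≈g (x ∷ t)))

  sumTuples-*ˡ : ∀ ν n (f : (Fin n → Fin ν) → Carrier) x →
                 sumTuples ν n (λ a → x * f a) ≈ x * sumTuples ν n f
  sumTuples-*ˡ ν zero    f x = ≈-refl
  sumTuples-*ˡ ν (suc n) f x rewrite sumTuples-suc ν n (λ a → x * f a) | sumTuples-suc ν n f =
    ≈-trans (sum-cong-≋ {ν} (λ y → sumTuples-*ˡ ν n (λ t → f (y ∷ t)) x))
            (≈-sym (*-distribˡ-sum x (λ y → sumTuples ν n (λ t → f (y ∷ t)))))

  sumTuples-prodFin : ∀ ν n (F : Fin n → Fin ν → Carrier) →
                      sumTuples ν n (λ a → prodFin n (λ i → F i (a i))) ≈ prodFin n (λ i → sum (F i))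
  sumTuples-prodFin ν zero    F = ≈-refl
  sumTuples-prodFin ν (suc n) F
    rewrite sumTuples-suc ν n (λ a → prodFin (suc n) (λ i → F i (a i))) = begin
    sum (λ x → sumTuples ν n (λ t → F fzero x * prodFin n (λ i → F (fsuc i) (t i))))
      ≈⟨ sum-cong-≋ {ν} (λ x → sumTuples-*ˡ ν n _ (F fzero x)) ⟩
    sum (λ x → F fzero x * sumTuples ν n (λ t → prodFin n (λ i → F (fsuc i) (t i))))
      ≈⟨ sum-cong-≋ {ν} (λ x → *-congˡ (sumTuples-prodFin ν n (F ∘ fsuc))) ⟩
    sum (λ x → F fzero x * prodFin n (λ i → sum (F (fsuc i))))
      ≈⟨ *-distribʳ-sum _ (F fzero) ⟨
    sum (F fzero) * prodFin n (λ i → sum (F (fsuc i)))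
      ∎

  ^-pairing : ∀ {ν} n (w : Carrier) (a g : Fin n → Fin ν) →
              w ^ pairing a g ≈ prodFin n (λ i → w ^ (toℕ (a i) ℕ.* toℕ (g i)))
  ^-pairing zero    w a g = ≈-refl
  ^-pairing (suc n) w a g =
    ≈-trans (^-homo-* w (toℕ (a fzero) ℕ.* toℕ (g fzero)) (pairing (a ∘ fsuc) (g ∘ fsuc)))
            (*-congˡ (^-pairing n w (a ∘ fsuc) (g ∘ fsuc)))

  if-allFin≈prodFin : ∀ n (b : Fin n → Bool) (f : Fin n → Carrier) →
                      (if allFin n b then prodFin n f else 0#) ≈ prodFin n (λ i → if b i then f i else 0#)
  if-allFin≈prodFin zero    b f = ≈-refl
  if-allFin≈prodFin (suc n) b f with b fzero
  ... | true  = ≈-trans (≈-sym (*-if (allFin n (b ∘ fsuc)) (f fzero) _))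
                        (*-congˡ (if-allFin≈prodFin n (b ∘ fsuc) (f ∘ fsuc)))
  ... | false = ≈-sym (zeroˡ _)

  masked-ψ≈prodFin : ∀ {ν} n (b : Fin n → Fin ν → Bool) (a g : Fin n → Fin ν) →
                     (if allFin n (λ i → b i (a i)) then ψ a g else 0#)
                       ≈ prodFin n (λ i → if b i (a i) then ζ ^ (toℕ (a i) ℕ.* toℕ (g i)) else 0#)
  masked-ψ≈prodFin n b a g =
    ≈-trans (if-then-cong (allFin n (λ i → b i (a i))) ψ≈prodFin) (if-allFin≈prodFin n _ _)
    where
    ψ≈prodFin : ψ a g ≈ prodFin n (λ i → ζ ^ (toℕ (a i) ℕ.* toℕ (g i)))
    ψ≈prodFin = ≈-trans (reflexive (pow≡^ ζ (pairing a g))) (^-pairing n ζ a g)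

  ψ-𝟎 : ∀ {ν n} .{{_ : NonZero ν}} (a : Fin n → Fin ν) → ψ a 𝟎 ≡ 1#
  ψ-𝟎 {suc ν} a = cong (pow ζ) (pairing≡0 a _ (λ _ → inj₂ _))

  χ≈masked-ψ-sum : ∀ {m n} (I : Subset n) (g : Fin n → Fin (suc (suc m))) →
                   χ I g ≈ sumTuples _ n (λ a → if vanishesExactlyOn I a then ψ a g else 0#)
  χ≈masked-ψ-sum {n = n} I g = sumTuples-cong _ n (λ a → begin
    (if inX I a then ψ a 𝟎 * ψ a g else 0#)
      ≡⟨ cong (λ b → if b then ψ a 𝟎 * ψ a g else 0#) (inX≡vanishesExactlyOn I a) ⟩
    (if vanishesExactlyOn I a then ψ a 𝟎 * ψ a g else 0#)
      ≈⟨ if-then-cong (vanishesExactlyOn I a) (≈-trans (*-congʳ (reflexive (ψ-𝟎 a))) (*-identityˡ _)) ⟩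
    (if vanishesExactlyOn I a then ψ a g else 0#)
      ∎)

  character-sum : NoZeroDivisors → ∀ {ν} → IsPrimitiveRoot ν → (y : Fin ν) →
                  sum (λ (x : Fin ν) → ζ ^ (toℕ x ℕ.* toℕ y)) ≈ reg y
  character-sum _ {ν} _ fzero = begin
    sum {ν} (λ x → ζ ^ (toℕ x ℕ.* 0))  ≡⟨ sum-cong-≗ {ν} (λ x → cong (ζ ^_) (ℕP.*-zeroʳ (toℕ x))) ⟩
    sum {ν} (λ _ → 1#)                 ≡⟨ sum-ones≡fromℕ ν ⟩
    fromℕ ν                            ∎
  character-sum noZeroDivisors {ν} (pow-ζ-ν≈1 , pow-ζ-k≉1) (fsuc k) = begin
    sum {ν} (λ x → ζ ^ (toℕ x ℕ.* t))  ≈⟨ sum-cong-≋ {ν} (λ x → [ζ^t]^x≈ζ^[x*t] (toℕ x)) ⟨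
    sum (powers (ζ ^ t) ν)
      ≈⟨ sum-powers≈0 noZeroDivisors ν ζ^t≉1 (^-root-of-unity ν t ζ^ν≈1) ⟩
    0#                                 ∎
    where
    t = suc (toℕ k)
    [ζ^t]^x≈ζ^[x*t] : ∀ x → (ζ ^ t) ^ x ≈ ζ ^ (x ℕ.* t)
    [ζ^t]^x≈ζ^[x*t] x = ≈-trans (^-assocʳ ζ t x) (reflexive (cong (ζ ^_) (ℕP.*-comm t x)))
    ζ^ν≈1 : ζ ^ ν ≈ 1#
    ζ^ν≈1 = ≈-trans (reflexive (sym (pow≡^ ζ ν))) pow-ζ-ν≈1
    ζ^t≉1 : ¬ ζ ^ t ≈ 1#
    ζ^t≉1 = pow-ζ-k≉1 t z<s (toℕ<n (fsuc k)) ∘ ≈-trans (reflexive (pow≡^ ζ t))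

  coordinate-sum : NoZeroDivisors → ∀ {k} → IsPrimitiveRoot (suc k) → (b : Bool) (y : Fin (suc k)) →
                   sum {suc k} (λ x → if vanishesIff b x then ζ ^ (toℕ x ℕ.* toℕ y) else 0#)
                     ≈ (if b then 𝟙 y else reg y - 𝟙 y)
  coordinate-sum _ {k} _ true y = begin
    1# + sum {k} (λ _ → 0#)  ≈⟨ +-congˡ (sum-replicate-zero k) ⟩
    1# + 0#                  ≈⟨ +-identityʳ 1# ⟩
    1#                       ∎
  coordinate-sum noZeroDivisors {k} prim false y = begin
    0# + S             ≈⟨ +-identityˡ S ⟩
    S                  ≈⟨ xyx⁻¹≈y 1# S ⟨
    1# + S - 1#        ≈⟨ +-congʳ (character-sum noZeroDivisors prim y) ⟩
    reg y - 1#         ∎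
    where
    -- 1# + S is the whole character sum, whose x = 0 term is ζ^0.
    S = sum {k} (λ x → ζ ^ (toℕ (fsuc x) ℕ.* toℕ y))

proposition3p2 : {c ℓ : Level} (R : CommutativeRing c ℓ) (ζ : CommutativeRing.Carrier R)
    → Characters.IsIntegralDomain R ζ
    → (ν : ℕ) → .{{ _ : NonZero ν }} → 1 < ν → Characters.IsPrimitiveRoot R ζ ν
    → (n : ℕ) (I : Subset n) (g : Fin n → Fin ν)
    → CommutativeRing._≈_ R (Characters.χ R ζ I g) (Characters.rhs R ζ I g)
proposition3p2 R ζ (_ , noZeroDivisors) ν@(suc (suc m)) (s≤s (s≤s z≤n)) prim n I g = begin
  χ I g
    ≈⟨ χ≈masked-ψ-sum I g ⟩
  sumTuples ν n (λ a → if vanishesExactlyOn I a then ψ a g else 0#)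
    ≈⟨ sumTuples-cong ν n (λ a → masked-ψ≈prodFin n (vanishesIff ∘ ⌊_⌋ ∘ (_∈? I)) a g) ⟩
  sumTuples ν n (λ a → prodFin n (λ i → F i (a i)))
    ≈⟨ sumTuples-prodFin ν n F ⟩
  prodFin n (λ i → sum {ν} (F i))
    ≈⟨ prodFin-cong n (λ i → coordinate-sum noZeroDivisors prim ⌊ i ∈? I ⌋ (g i)) ⟩
  rhs I g
    ∎
  where
  open CommutativeRing R
  open Characters R ζ
  open CharacterSums R ζ
  open import Algebra.Properties.Semiring.Sum semiring using (sum)
  open import Algebra.Properties.Semiring.Exp semiring using (_^_)
  open import Relation.Binary.Reasoning.Setoid setoid
  F : Fin n → Fin ν → Carrier
  F i x = if vanishesIff ⌊ i ∈? I ⌋ x then ζ ^ (toℕ x ℕ.* toℕ (g i)) else 0#
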